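{- (i) Each of the rules $(ref)$ and $(tra)$ can be permuted above each rule in $\{(\bot_l),(\wedge_l),(\wedge_r),(\vee_l),(\vee_r),(\supset_r),(\neg_l),(\neg_r),(\exists_l),(\exists_r),(\forall_r)\}$. (ii) Each of the rules $(nd)$ and $(cd)$ can be permuted above each rule in $\{(\bot_l),(\wedge_l),(\wedge_r),(\vee_l),(\vee_r),(\supset_l),(\supset_r),(\neg_l),(\neg_r),(\exists_l),(\forall_r)\}$.
   Context: Labelled sequents $\mathcal{R},\Gamma\Rightarrow\Delta$: $\mathcal{R}$ a multiset of relational atoms $w\le v$ and domain atoms $a\in D_w$ ($w,v$ labels, $a$ a parameter), $\Gamma,\Delta$ multisets of labelled formulas $w:A$ with $A$ a first-order intuitionistic formula (bound variables distinct from parameters; $A[a/x]$ is substitution of $a$ for free $x$; $\neg A$ abbreviates $A\supset\bot$). Rules: $(\bot_l)$: $\mathcal{R},w:\bot,\Gamma\Rightarrow\Delta$ (axiom); $(\wedge_l)$: from $\mathcal{R},w:A,w:B,\Gamma\Rightarrow\Delta$ infer $\mathcal{R},w:A\wedge B,\Gamma\Rightarrow\Delta$; $(\wedge_r)$: from $\mathcal{R},\Gamma\Rightarrow\Delta,w:A$ and $\mathcal{R},\Gamma\Rightarrow\Delta,w:B$ infer $\mathcal{R},\Gamma\Rightarrow\Delta,w:A\wedge B$; $(\vee_l)$: from $\mathcal{R},w:A,\Gamma\Rightarrow\Delta$ and $\mathcal{R},w:B,\Gamma\Rightarrow\Delta$ infer $\mathcal{R},w:A\vee B,\Gamma\Rightarrow\Delta$;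 $(\vee_r)$: from $\mathcal{R},\Gamma\Rightarrow\Delta,w:A,w:B$ infer $\mathcal{R},\Gamma\Rightarrow\Delta,w:A\vee B$; $(\supset_r)$: from $\mathcal{R},w\le v,v:A,\Gamma\Rightarrow\Delta,v:B$ infer $\mathcal{R},\Gamma\Rightarrow\Delta,w:A\supset B$, $v$ not in the conclusion; $(\supset_l)$: from $\mathcal{R},w\le v,w:A\supset B,\Gamma\Rightarrow\Delta,v:A$ and $\mathcal{R},w\le v,w:A\supset B,v:B,\Gamma\Rightarrow\Delta$ infer $\mathcal{R},w\le v,w:A\supset B,\Gamma\Rightarrow\Delta$; $(\neg_r)$: from $\mathcal{R},w\le v,v:A,\Gamma\Rightarrow\Delta$ infer $\mathcal{R},\Gamma\Rightarrow\Delta,w:\neg A$, $v$ not in the conclusion; $(\neg_l)$: from $\mathcal{R},w:\neg A,\Gamma\Rightarrow\Delta,w:A$ infer $\mathcal{R},w:\neg A,\Gamma\Rightarrow\Delta$; $(\exists_l)$: from $\mathcal{R},a\in D_w,w:A[a/x],\Gamma\Rightarrow\Delta$ infer $\mathcal{R},w:\exists xA,\Gamma\Rightarrow\Delta$, $a$ not in the conclusion; $(\exists_r)$: from $\mathcal{R},a\in D_w,\Gamma\Rightarrow\Delta,w:A[a/x],w:\exists xA$ infer $\mathcal{R},a\in D_w,\Gamma\Rightarrow\Delta,w:\exists xA$; $(\forall_r)$: from $\mathcal{R},w\le v,a\in D_v,\Gamma\Rightarrow\Delta,v:A[a/x]$ infer $\mathcal{R},\Gamma\Rightarrow\Delta,w:\forall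 xA$, $a,v$ not in the conclusion; $(ref)$: from $\mathcal{R},w\le w,\Gamma\Rightarrow\Delta$ infer $\mathcal{R},\Gamma\Rightarrow\Delta$; $(tra)$: from $\mathcal{R},w\le v,v\le u,w\le u,\Gamma\Rightarrow\Delta$ infer $\mathcal{R},w\le v,v\le u,\Gamma\Rightarrow\Delta$; $(nd)$: from $\mathcal{R},w\le v,a\in D_w,a\in D_v,\Gamma\Rightarrow\Delta$ infer $\mathcal{R},w\le v,a\in D_w,\Gamma\Rightarrow\Delta$; $(cd)$: from $\mathcal{R},w\le v,a\in D_v,a\in D_w,\Gamma\Rightarrow\Delta$ infer $\mathcal{R},w\le v,a\in D_v,\Gamma\Rightarrow\Delta$. A one-premise rule $\rho$ can be permuted above a rule $r$ if, whenever an instance of $r$ with premises $S_1,\dots,S_k$ ($k\ge0$) and conclusion $S$ is followed by an instance of $\rho$ with premise $S$ and conclusion $S'$, the sequent $S'$ is the conclusion of an instance of $r$ whose premises are obtained from $S_1,\dots,S_k$ by instances of $\rho$ (when $k=0$, $S'$ is itself an instance of $r$). -}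

module Defs where

open import Data.Nat using (ℕ; _≟_)
open import Data.List using (List; []; _∷_; _++_; concatMap)
open import Data.List.Membership.Propositional using (_∈_; _∉_)
open import Data.List.Relation.Binary.Permutation.Propositional using (_↭_)
open import Data.List.Relation.Binary.Pointwise using (Pointwise)
open import Data.Product using (Σ; _×_; _,_)
open import Relation.Nullary using (yes; no)

-- Syntax of first-order intuitionistic formulas.
-- Bound variables (Var) and parameters (Par) are disjoint sorts, so
-- "bound variables distinct from parameters" holds by construction.

Label : Set
Label = ℕ

Par : Set
Par = ℕ

Var : Set
Var = ℕ

PredSym : Set
PredSym = ℕ

data Term : Set where
  var : Var → Term
  par : Par → Term

infixr 6 _∧ᶠ_
infixr 5 _∨ᶠ_
infixr 4 _⊃_

data Fm : Set where
  atom  : PredSym → List Term → Fm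
  ⊥ᶠ    : Fm
  _∧ᶠ_  : Fm → Fm → Fm
  _∨ᶠ_  : Fm → Fm → Fm
  _⊃_   : Fm → Fm → Fm
  ∀ᶠ    : Var → Fm → Fm
  ∃ᶠ    : Var → Fm → Fm

¬ᶠ : Fm → Fm
¬ᶠ A = A ⊃ ⊥ᶠ

substT : Term → Par → Var → Term
substT (var y) a x with y ≟ x
... | yes _ = par a
... | no  _ = var y
substT (par b) a x = par b

substTs : List Term → Par → Var → List Term
substTs []       a x = []
substTs (t ∷ ts) a x = substT t a x ∷ substTs ts a x

_[_/_] : Fm → Par → Var → Fm
atom P ts [ a / x ] = atom P (substTs ts a x)
⊥ᶠ        [ a / x ] = ⊥ᶠ
(A ∧ᶠ B)  [ a / x ] = (A [ a / x ]) ∧ᶠ (B [ a / x ])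
(A ∨ᶠ B)  [ a / x ] = (A [ a / x ]) ∨ᶠ (B [ a / x ])
(A ⊃ B)   [ a / x ] = (A [ a / x ]) ⊃ (B [ a / x ])
∀ᶠ y A    [ a / x ] with y ≟ x
... | yes _ = ∀ᶠ y A
... | no  _ = ∀ᶠ y (A [ a / x ])
∃ᶠ y A    [ a / x ] with y ≟ x
... | yes _ = ∃ᶠ y A
... | no  _ = ∃ᶠ y (A [ a / x ])

paramsT : Term → List Par
paramsT (var _) = []
paramsT (par a) = a ∷ []

paramsTs : List Term → List Par
paramsTs []       = []
paramsTs (t ∷ ts) = paramsT t ++ paramsTs ts

paramsF : Fm → List Par
paramsF (atom P ts) = paramsTs ts
paramsF ⊥ᶠ          = []
paramsF (A ∧ᶠ B)    = paramsF A ++ paramsF B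
paramsF (A ∨ᶠ B)    = paramsF A ++ paramsF B
paramsF (A ⊃ B)     = paramsF A ++ paramsF B
paramsF (∀ᶠ _ A)    = paramsF A
paramsF (∃ᶠ _ A)    = paramsF A

data RAtom : Set where
  _≤ₗ_ : Label → Label → RAtom
  _∈D_ : Par → Label → RAtom

data LFm : Set where
  _∶_ : Label → Fm → LFm

infix 3 _∶_

-- R , Γ ⇒ Δ  with R, Γ, Δ multisets (lists up to permutation, see _≈ˢ_)
record Seq : Set where
  constructor ⟨_,_⇒_⟩
  field
    rel : List RAtom
    ant : List LFm
    suc : List LFm
open Seq public

labelsR : RAtom → List Label
labelsR (w ≤ₗ v) = w ∷ v ∷ []
labelsR (a ∈D w) = w ∷ []

labelsL : LFm → List Label
labelsL (w ∶ A) = w ∷ []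

paramsR : RAtom → List Par
paramsR (w ≤ₗ v) = []
paramsR (a ∈D w) = a ∷ []

paramsL : LFm → List Par
paramsL (w ∶ A) = paramsF A

labels : Seq → List Label
labels S = concatMap labelsR (rel S) ++ concatMap labelsL (ant S) ++ concatMap labelsL (suc S)

params : Seq → List Par
params S = concatMap paramsR (rel S) ++ concatMap paramsL (ant S) ++ concatMap paramsL (suc S)

_≈ˢ_ : Seq → Seq → Set
S ≈ˢ T = (rel S ↭ rel T) × (ant S ↭ ant T) × (suc S ↭ suc T)

data Rule : Set where
  ⊥ₗ ∧ₗ ∧ᵣ ∨ₗ ∨ᵣ ⊃ᵣ ⊃ₗ ¬ᵣ ¬ₗ ∃ₗ ∃ᵣ ∀ᵣ ref tra nd cd : Rule

-- Inst₀ r Ps C : a rule instance of r with premises Ps and conclusion C,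
-- written with the principal/active parts at the front of each multiset.
data Inst₀ : Rule → List Seq → Seq → Set where
  i⊥ₗ : ∀ {R Γ Δ w} →
    Inst₀ ⊥ₗ [] ⟨ R , (w ∶ ⊥ᶠ) ∷ Γ ⇒ Δ ⟩
  i∧ₗ : ∀ {R Γ Δ w A B} →
    Inst₀ ∧ₗ (⟨ R , (w ∶ A) ∷ (w ∶ B) ∷ Γ ⇒ Δ ⟩ ∷ [])
             ⟨ R , (w ∶ A ∧ᶠ B) ∷ Γ ⇒ Δ ⟩
  i∧ᵣ : ∀ {R Γ Δ w A B} →
    Inst₀ ∧ᵣ (⟨ R , Γ ⇒ (w ∶ A) ∷ Δ ⟩ ∷ ⟨ R , Γ ⇒ (w ∶ B) ∷ Δ ⟩ ∷ [])
             ⟨ R , Γ ⇒ (w ∶ A ∧ᶠ B) ∷ Δ ⟩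
  i∨ₗ : ∀ {R Γ Δ w A B} →
    Inst₀ ∨ₗ (⟨ R , (w ∶ A) ∷ Γ ⇒ Δ ⟩ ∷ ⟨ R , (w ∶ B) ∷ Γ ⇒ Δ ⟩ ∷ [])
             ⟨ R , (w ∶ A ∨ᶠ B) ∷ Γ ⇒ Δ ⟩
  i∨ᵣ : ∀ {R Γ Δ w A B} →
    Inst₀ ∨ᵣ (⟨ R , Γ ⇒ (w ∶ A) ∷ (w ∶ B) ∷ Δ ⟩ ∷ [])
             ⟨ R , Γ ⇒ (w ∶ A ∨ᶠ B) ∷ Δ ⟩
  i⊃ᵣ : ∀ {R Γ Δ w v A B} →
    v ∉ labels ⟨ R , Γ ⇒ (w ∶ A ⊃ B) ∷ Δ ⟩ →
    Inst₀ ⊃ᵣ (⟨ (w ≤ₗ v) ∷ R , (v ∶ A) ∷ Γ ⇒ (v ∶ B) ∷ Δ ⟩ ∷ [])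
             ⟨ R , Γ ⇒ (w ∶ A ⊃ B) ∷ Δ ⟩
  i⊃ₗ : ∀ {R Γ Δ w v A B} →
    Inst₀ ⊃ₗ (⟨ (w ≤ₗ v) ∷ R , (w ∶ A ⊃ B) ∷ Γ ⇒ (v ∶ A) ∷ Δ ⟩ ∷
              ⟨ (w ≤ₗ v) ∷ R , (w ∶ A ⊃ B) ∷ (v ∶ B) ∷ Γ ⇒ Δ ⟩ ∷ [])
             ⟨ (w ≤ₗ v) ∷ R , (w ∶ A ⊃ B) ∷ Γ ⇒ Δ ⟩
  i¬ᵣ : ∀ {R Γ Δ w v A} →
    v ∉ labels ⟨ R , Γ ⇒ (w ∶ ¬ᶠ A) ∷ Δ ⟩ →
    Inst₀ ¬ᵣ (⟨ (w ≤ₗ v) ∷ R , (v ∶ A) ∷ Γ ⇒ Δ ⟩ ∷ [])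
             ⟨ R , Γ ⇒ (w ∶ ¬ᶠ A) ∷ Δ ⟩
  i¬ₗ : ∀ {R Γ Δ w A} →
    Inst₀ ¬ₗ (⟨ R , (w ∶ ¬ᶠ A) ∷ Γ ⇒ (w ∶ A) ∷ Δ ⟩ ∷ [])
             ⟨ R , (w ∶ ¬ᶠ A) ∷ Γ ⇒ Δ ⟩
  i∃ₗ : ∀ {R Γ Δ w a x A} →
    a ∉ params ⟨ R , (w ∶ ∃ᶠ x A) ∷ Γ ⇒ Δ ⟩ →
    Inst₀ ∃ₗ (⟨ (a ∈D w) ∷ R , (w ∶ A [ a / x ]) ∷ Γ ⇒ Δ ⟩ ∷ [])
             ⟨ R , (w ∶ ∃ᶠ x A) ∷ Γ ⇒ Δ ⟩
  i∃ᵣ : ∀ {R Γ Δ w a x A} →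
    Inst₀ ∃ᵣ (⟨ (a ∈D w) ∷ R , Γ ⇒ (w ∶ A [ a / x ]) ∷ (w ∶ ∃ᶠ x A) ∷ Δ ⟩ ∷ [])
             ⟨ (a ∈D w) ∷ R , Γ ⇒ (w ∶ ∃ᶠ x A) ∷ Δ ⟩
  i∀ᵣ : ∀ {R Γ Δ w v a x A} →
    a ∉ params ⟨ R , Γ ⇒ (w ∶ ∀ᶠ x A) ∷ Δ ⟩ →
    v ∉ labels ⟨ R , Γ ⇒ (w ∶ ∀ᶠ x A) ∷ Δ ⟩ →
    Inst₀ ∀ᵣ (⟨ (w ≤ₗ v) ∷ (a ∈D v) ∷ R , Γ ⇒ (v ∶ A [ a / x ]) ∷ Δ ⟩ ∷ [])
             ⟨ R , Γ ⇒ (w ∶ ∀ᶠ x A) ∷ Δ ⟩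
  iref : ∀ {R Γ Δ w} →
    Inst₀ ref (⟨ (w ≤ₗ w) ∷ R , Γ ⇒ Δ ⟩ ∷ []) ⟨ R , Γ ⇒ Δ ⟩
  itra : ∀ {R Γ Δ w v u} →
    Inst₀ tra (⟨ (w ≤ₗ v) ∷ (v ≤ₗ u) ∷ (w ≤ₗ u) ∷ R , Γ ⇒ Δ ⟩ ∷ [])
              ⟨ (w ≤ₗ v) ∷ (v ≤ₗ u) ∷ R , Γ ⇒ Δ ⟩
  ind : ∀ {R Γ Δ w v a} →
    Inst₀ nd (⟨ (w ≤ₗ v) ∷ (a ∈D w) ∷ (a ∈D v) ∷ R , Γ ⇒ Δ ⟩ ∷ [])
             ⟨ (w ≤ₗ v) ∷ (a ∈D w) ∷ R , Γ ⇒ Δ ⟩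
  icd : ∀ {R Γ Δ w v a} →
    Inst₀ cd (⟨ (w ≤ₗ v) ∷ (a ∈D v) ∷ (a ∈D w) ∷ R , Γ ⇒ Δ ⟩ ∷ [])
             ⟨ (w ≤ₗ v) ∷ (a ∈D v) ∷ R , Γ ⇒ Δ ⟩

Inst : Rule → List Seq → Seq → Set
Inst r Ps C = Σ (List Seq) λ Ps₀ → Σ Seq λ C₀ →
  Inst₀ r Ps₀ C₀ × Pointwise _≈ˢ_ Ps Ps₀ × C ≈ˢ C₀

PermutableAbove : Rule → Rule → Set
PermutableAbove ρ r =
  ∀ (Ss : List Seq) (S S' : Seq) →
  Inst r Ss S → Inst ρ (S ∷ []) S' →
  Σ (List Seq) λ Ss' →
    Inst r Ss' S' × Pointwise (λ Sᵢ S'ᵢ → Inst ρ (Sᵢ ∷ []) S'ᵢ) Ss Ss'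

module Submission where

open import Defs
open import Data.List using (List; []; _∷_; _++_; map)
open import Data.List.Membership.Propositional using (_∈_)
open import Data.List.Membership.Propositional.Properties using (∈-++⁺ʳ; ∈-++⁻; ∈-∃++)
open import Data.List.Relation.Binary.Permutation.Propositional
  using (_↭_; ↭-refl; ↭-sym; ↭-trans; prep; module PermutationReasoning)
open import Data.List.Relation.Binary.Permutation.Propositional.Properties
  using (∈-resp-↭; ++⁺ˡ; shift; shifts; drop-∷)
open import Data.List.Relation.Binary.Pointwise using (Pointwise; []; _∷_)
import Data.List.Relation.Binary.Pointwise.Properties as Pointwise
open import Data.List.Relation.Binary.Subset.Propositional using (_⊆_)
import Data.List.Relation.Binary.Subset.Propositional.Properties as ⊆
open import Data.List.Relation.Unary.All as All using (All; []; _∷_)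
open import Data.List.Relation.Unary.Any using (here; there)
open import Data.Product using (Σ; ∃; _×_; _,_; proj₁; proj₂)
open import Data.Sum using (inj₁; inj₂)
open import Function using (_∘_)
open import Relation.Binary.PropositionalEquality using (_≡_; _≢_; refl)
open import Relation.Nullary using (contradiction)

-- Each of ref, tra, nd, cd only adds one relational atom e to the
-- premise.  A rule r of the list has a fixed relational part K in its
-- conclusion and is otherwise uniform in the relational context R; its
-- eigenvariable conditions only become weaker when R shrinks.  If e is of a
-- different kind from every atom of K (this is what excludes ⊃ₗ, whose K is
-- w ≤ v, for ref/tra, and ∃ᵣ, whose K is a ∈ D_w, for nd/cd), then e lies in
-- R, so r applies with e deleted from R, and the structural rule is applied
-- to each premise of r instead.

∈⇒↭-∷ : ∀ {A : Set} {x : A} {xs} → x ∈ xs → ∃ λ ys → xs ↭ x ∷ ys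
∈⇒↭-∷ {x = x} x∈xs with ys , zs , refl ← ∈-∃++ x∈xs = ys ++ zs , shift x ys zs

shift-↭ : ∀ {A : Set} {x : A} {xs ys} zs → xs ↭ x ∷ ys → zs ++ xs ↭ x ∷ zs ++ ys
shift-↭ {x = x} {ys = ys} zs xs↭x∷ys = ↭-trans (++⁺ˡ zs xs↭x∷ys) (shift x zs ys)

labels-⊆ : ∀ {R₂ R} Γ Δ → R₂ ⊆ R → labels ⟨ R₂ , Γ ⇒ Δ ⟩ ⊆ labels ⟨ R , Γ ⇒ Δ ⟩
labels-⊆ Γ Δ R₂⊆R = ⊆.++⁺ˡ _ (⊆.concatMap⁺ labelsR R₂⊆R)

params-⊆ : ∀ {R₂ R} Γ Δ → R₂ ⊆ R → params ⟨ R₂ , Γ ⇒ Δ ⟩ ⊆ params ⟨ R , Γ ⇒ Δ ⟩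
params-⊆ Γ Δ R₂⊆R = ⊆.++⁺ˡ _ (⊆.concatMap⁺ paramsR R₂⊆R)

≈ˢ-refl : ∀ {S} → S ≈ˢ S
≈ˢ-refl = ↭-refl , ↭-refl , ↭-refl

data AtomKind : Set where
  order domain : AtomKind

kind : RAtom → AtomKind
kind (_ ≤ₗ _) = order
kind (_ ∈D _) = domain

data Structural : AtomKind → Rule → Set where
  ref : Structural order ref
  tra : Structural order tra
  nd  : Structural domain nd
  cd  : Structural domain cd

-- r is a logical rule none of whose fixed relational atoms has kind k.
data Logical : AtomKind → Rule → Set where
  ⊥ₗ : ∀ {k} → Logical k ⊥ₗ
  ∧ₗ : ∀ {k} → Logical k ∧ₗ
  ∧ᵣ : ∀ {k} → Logical k ∧ᵣ
  ∨ₗ : ∀ {k} → Logical k ∨ₗ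
  ∨ᵣ : ∀ {k} → Logical k ∨ᵣ
  ⊃ₗ : Logical domain ⊃ₗ
  ⊃ᵣ : ∀ {k} → Logical k ⊃ᵣ
  ¬ₗ : ∀ {k} → Logical k ¬ₗ
  ¬ᵣ : ∀ {k} → Logical k ¬ᵣ
  ∃ₗ : ∀ {k} → Logical k ∃ₗ
  ∃ᵣ : Logical order ∃ᵣ
  ∀ᵣ : ∀ {k} → Logical k ∀ᵣ

record StructuralView (k : AtomKind) (ρ : Rule) (S S' : Seq) : Set where
  field
    side     : List RAtom
    new      : RAtom
    rest     : List RAtom
    new-kind : kind new ≡ k
    reapply  : ∀ R Γ Δ → Inst₀ ρ (⟨ side ++ new ∷ R , Γ ⇒ Δ ⟩ ∷ []) ⟨ side ++ R , Γ ⇒ Δ ⟩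
    rel-premise    : rel S ↭ side ++ new ∷ rest
    rel-conclusion : rel S' ↭ side ++ rest
    ant-conclusion : ant S' ↭ ant S
    suc-conclusion : suc S' ↭ suc S

structuralViewOf : ∀ {k ρ S S'} side {new rest Γ Δ} → kind new ≡ k →
  (∀ R Γ Δ → Inst₀ ρ (⟨ side ++ new ∷ R , Γ ⇒ Δ ⟩ ∷ []) ⟨ side ++ R , Γ ⇒ Δ ⟩) →
  S ≈ˢ ⟨ side ++ new ∷ rest , Γ ⇒ Δ ⟩ → S' ≈ˢ ⟨ side ++ rest , Γ ⇒ Δ ⟩ →
  StructuralView k ρ S S'
structuralViewOf side new-kind reapply (relS , antS , sucS) (relS' , antS' , sucS') = record
  { side = side ; new-kind = new-kind ; reapply = reapply
  ; rel-premise = relS ; rel-conclusion = relS'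
  ; ant-conclusion = ↭-trans antS' (↭-sym antS) ; suc-conclusion = ↭-trans sucS' (↭-sym sucS) }

structuralView : ∀ {k ρ S S'} → Structural k ρ → Inst ρ (S ∷ []) S' → StructuralView k ρ S S'
structuralView ref (_ , _ , iref , premise ∷ [] , conclusion) =
  structuralViewOf [] refl (λ _ _ _ → iref) premise conclusion
structuralView tra (_ , _ , itra , premise ∷ [] , conclusion) =
  structuralViewOf (_ ∷ _ ∷ []) refl (λ _ _ _ → itra) premise conclusion
structuralView nd (_ , _ , ind , premise ∷ [] , conclusion) =
  structuralViewOf (_ ∷ _ ∷ []) refl (λ _ _ _ → ind) premise conclusion
structuralView cd (_ , _ , icd , premise ∷ [] , conclusion) =
  structuralViewOf (_ ∷ _ ∷ []) refl (λ _ _ _ → icd) premise conclusion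

Permuted : Rule → Rule → List Seq → Seq → Set
Permuted ρ r Ss S' = Σ (List Seq) λ Ss' →
  Inst r Ss' S' × Pointwise (λ Sᵢ S'ᵢ → Inst ρ (Sᵢ ∷ []) S'ᵢ) Ss Ss'

PremiseShape : Set
PremiseShape = List RAtom × List LFm × List LFm

-- K is the fixed relational part of the conclusion, R its context, and X
-- the atoms the premise adds to them.
premise : List RAtom → List RAtom → PremiseShape → Seq
premise K R (X , Γ , Δ) = ⟨ X ++ K ++ R , Γ ⇒ Δ ⟩

permute-over-context :
  ∀ {k ρ r} (K R : List RAtom) (Γ Δ : List LFm) (shapes : List PremiseShape) →
  All (λ y → kind y ≢ k) K →
  (∀ {R₂} → R₂ ⊆ R → Inst₀ r (map (premise K R₂) shapes) ⟨ K ++ R₂ , Γ ⇒ Δ ⟩) →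
  ∀ {Ss S S'} → Pointwise _≈ˢ_ Ss (map (premise K R) shapes) → S ≈ˢ ⟨ K ++ R , Γ ⇒ Δ ⟩ →
  StructuralView k ρ S S' → Permuted ρ r Ss S'
permute-over-context {ρ = ρ} K R Γ Δ shapes avoidsK shrink {S = S} pw (relS , antS , sucS) V =
  map (premise K R₁) shapes
  , (_ , _ , shrink R₁⊆R , Pointwise.refl ≈ˢ-refl
    , ↭-trans rel-conclusion (↭-sym K++R₁↭) , ↭-trans ant-conclusion antS , ↭-trans suc-conclusion sucS)
  , permute-premises shapes pw
  where
  open StructuralView V
  open PermutationReasoning

  new∈R : new ∈ R
  new∈R with ∈-++⁻ K (∈-resp-↭ (↭-trans (↭-sym rel-premise) relS) (∈-++⁺ʳ side (here refl)))
  ... | inj₁ new∈K = contradiction new-kind (All.lookup avoidsK new∈K)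
  ... | inj₂ new∈R = new∈R

  R₁ : List RAtom
  R₁ = proj₁ (∈⇒↭-∷ new∈R)

  R↭ : R ↭ new ∷ R₁
  R↭ = proj₂ (∈⇒↭-∷ new∈R)

  R₁⊆R : R₁ ⊆ R
  R₁⊆R = ∈-resp-↭ (↭-sym R↭) ∘ there

  K++R↭ : K ++ R ↭ new ∷ K ++ R₁
  K++R↭ = shift-↭ K R↭

  K++R₁↭ : K ++ R₁ ↭ side ++ rest
  K++R₁↭ = drop-∷ (begin
    new ∷ K ++ R₁        ↭⟨ ↭-sym K++R↭ ⟩
    K ++ R               ↭⟨ ↭-sym relS ⟩
    rel S                ↭⟨ rel-premise ⟩
    side ++ new ∷ rest   ↭⟨ shift new side rest ⟩
    new ∷ side ++ rest   ∎)

  permute-premise : ∀ {Sᵢ} t → Sᵢ ≈ˢ premise K R t → Inst ρ (Sᵢ ∷ []) (premise K R₁ t)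
  permute-premise (X , Γᵢ , Δᵢ) (relᵢ , antᵢ , sucᵢ) =
    _ , _ , reapply (X ++ rest) Γᵢ Δᵢ , (↭-trans relᵢ before , antᵢ , sucᵢ) ∷ [] , (after , ↭-refl , ↭-refl)
    where
    after : X ++ K ++ R₁ ↭ side ++ X ++ rest
    after = ↭-trans (++⁺ˡ X K++R₁↭) (shifts X side)
    before : X ++ K ++ R ↭ side ++ new ∷ X ++ rest
    before = begin
      X ++ K ++ R             ↭⟨ shift-↭ X K++R↭ ⟩
      new ∷ X ++ K ++ R₁      ↭⟨ prep new after ⟩
      new ∷ side ++ X ++ rest ↭⟨ ↭-sym (shift new side (X ++ rest)) ⟩
      side ++ new ∷ X ++ rest ∎

  permute-premises : ∀ ts {Ss} → Pointwise _≈ˢ_ Ss (map (premise K R) ts) →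
    Pointwise (λ Sᵢ S'ᵢ → Inst ρ (Sᵢ ∷ []) S'ᵢ) Ss (map (premise K R₁) ts)
  permute-premises []       []         = []
  permute-premises (t ∷ ts) (eq ∷ pw′) = permute-premise t eq ∷ permute-premises ts pw′

permute-logical : ∀ {k ρ r Ps C} → Logical k r → Inst₀ r Ps C →
  ∀ {Ss S S'} → Pointwise _≈ˢ_ Ss Ps → S ≈ˢ C → StructuralView k ρ S S' → Permuted ρ r Ss S'
permute-logical ⊥ₗ (i⊥ₗ {R} {_} {Δ}) =
  permute-over-context [] R _ Δ [] [] (λ _ → i⊥ₗ)
permute-logical ∧ₗ (i∧ₗ {R} {Γ} {Δ} {w} {A} {B}) =
  permute-over-context [] R _ Δ (([] , (w ∶ A) ∷ (w ∶ B) ∷ Γ , Δ) ∷ []) [] (λ _ → i∧ₗ)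
permute-logical ∧ᵣ (i∧ᵣ {R} {Γ} {Δ} {w} {A} {B}) =
  permute-over-context [] R Γ _ (([] , Γ , (w ∶ A) ∷ Δ) ∷ ([] , Γ , (w ∶ B) ∷ Δ) ∷ []) [] (λ _ → i∧ᵣ)
permute-logical ∨ₗ (i∨ₗ {R} {Γ} {Δ} {w} {A} {B}) =
  permute-over-context [] R _ Δ (([] , (w ∶ A) ∷ Γ , Δ) ∷ ([] , (w ∶ B) ∷ Γ , Δ) ∷ []) [] (λ _ → i∨ₗ)
permute-logical ∨ᵣ (i∨ᵣ {R} {Γ} {Δ} {w} {A} {B}) =
  permute-over-context [] R Γ _ (([] , Γ , (w ∶ A) ∷ (w ∶ B) ∷ Δ) ∷ []) [] (λ _ → i∨ᵣ)
permute-logical ⊃ₗ (i⊃ₗ {R} {Γ} {Δ} {w} {v} {A} {B}) =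
  permute-over-context ((w ≤ₗ v) ∷ []) R _ Δ
    (([] , (w ∶ A ⊃ B) ∷ Γ , (v ∶ A) ∷ Δ) ∷ ([] , (w ∶ A ⊃ B) ∷ (v ∶ B) ∷ Γ , Δ) ∷ [])
    ((λ ()) ∷ []) (λ _ → i⊃ₗ)
permute-logical ⊃ᵣ (i⊃ᵣ {R} {Γ} {Δ} {w} {v} {A} {B} v-fresh) =
  permute-over-context [] R Γ _ (((w ≤ₗ v) ∷ [] , (v ∶ A) ∷ Γ , (v ∶ B) ∷ Δ) ∷ []) []
    (λ R₂⊆R → i⊃ᵣ (v-fresh ∘ labels-⊆ Γ ((w ∶ A ⊃ B) ∷ Δ) R₂⊆R))
permute-logical ¬ₗ (i¬ₗ {R} {Γ} {Δ} {w} {A}) =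
  permute-over-context [] R _ Δ (([] , (w ∶ ¬ᶠ A) ∷ Γ , (w ∶ A) ∷ Δ) ∷ []) [] (λ _ → i¬ₗ)
permute-logical ¬ᵣ (i¬ᵣ {R} {Γ} {Δ} {w} {v} {A} v-fresh) =
  permute-over-context [] R Γ _ (((w ≤ₗ v) ∷ [] , (v ∶ A) ∷ Γ , Δ) ∷ []) []
    (λ R₂⊆R → i¬ᵣ (v-fresh ∘ labels-⊆ Γ ((w ∶ ¬ᶠ A) ∷ Δ) R₂⊆R))
permute-logical ∃ₗ (i∃ₗ {R} {Γ} {Δ} {w} {a} {x} {A} a-fresh) =
  permute-over-context [] R _ Δ (((a ∈D w) ∷ [] , (w ∶ A [ a / x ]) ∷ Γ , Δ) ∷ []) []
    (λ R₂⊆R → i∃ₗ (a-fresh ∘ params-⊆ ((w ∶ ∃ᶠ x A) ∷ Γ) Δ R₂⊆R))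
permute-logical ∃ᵣ (i∃ᵣ {R} {Γ} {Δ} {w} {a} {x} {A}) =
  permute-over-context ((a ∈D w) ∷ []) R Γ _
    (([] , Γ , (w ∶ A [ a / x ]) ∷ (w ∶ ∃ᶠ x A) ∷ Δ) ∷ [])
    ((λ ()) ∷ []) (λ _ → i∃ᵣ)
permute-logical ∀ᵣ (i∀ᵣ {R} {Γ} {Δ} {w} {v} {a} {x} {A} a-fresh v-fresh) =
  permute-over-context [] R Γ _ (((w ≤ₗ v) ∷ (a ∈D v) ∷ [] , Γ , (v ∶ A [ a / x ]) ∷ Δ) ∷ []) []
    (λ R₂⊆R → i∀ᵣ (a-fresh ∘ params-⊆ Γ ((w ∶ ∀ᶠ x A) ∷ Δ) R₂⊆R)
                  (v-fresh ∘ labels-⊆ Γ ((w ∶ ∀ᶠ x A) ∷ Δ) R₂⊆R))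

permutableAbove : ∀ {k ρ r} → Structural k ρ → Logical k r → PermutableAbove ρ r
permutableAbove structural logical _ _ _ (_ , _ , instance₀ , premises , conclusion) ρ-instance =
  permute-logical logical instance₀ premises conclusion (structuralView structural ρ-instance)

order-structural : All (Structural order) (ref ∷ tra ∷ [])
order-structural = ref ∷ tra ∷ []

domain-structural : All (Structural domain) (nd ∷ cd ∷ [])
domain-structural = nd ∷ cd ∷ []

order-logical : All (Logical order) (⊥ₗ ∷ ∧ₗ ∷ ∧ᵣ ∷ ∨ₗ ∷ ∨ᵣ ∷ ⊃ᵣ ∷ ¬ₗ ∷ ¬ᵣ ∷ ∃ₗ ∷ ∃ᵣ ∷ ∀ᵣ ∷ [])
order-logical = ⊥ₗ ∷ ∧ₗ ∷ ∧ᵣ ∷ ∨ₗ ∷ ∨ᵣ ∷ ⊃ᵣ ∷ ¬ₗ ∷ ¬ᵣ ∷ ∃ₗ ∷ ∃ᵣ ∷ ∀ᵣ ∷ []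

domain-logical : All (Logical domain) (⊥ₗ ∷ ∧ₗ ∷ ∧ᵣ ∷ ∨ₗ ∷ ∨ᵣ ∷ ⊃ₗ ∷ ⊃ᵣ ∷ ¬ₗ ∷ ¬ᵣ ∷ ∃ₗ ∷ ∀ᵣ ∷ [])
domain-logical = ⊥ₗ ∷ ∧ₗ ∷ ∧ᵣ ∷ ∨ₗ ∷ ∨ᵣ ∷ ⊃ₗ ∷ ⊃ᵣ ∷ ¬ₗ ∷ ¬ᵣ ∷ ∃ₗ ∷ ∀ᵣ ∷ []

lemma2 :
    (∀ {ρ r : Rule} → ρ ∈ ref ∷ tra ∷ [] →
       r ∈ ⊥ₗ ∷ ∧ₗ ∷ ∧ᵣ ∷ ∨ₗ ∷ ∨ᵣ ∷ ⊃ᵣ ∷ ¬ₗ ∷ ¬ᵣ ∷ ∃ₗ ∷ ∃ᵣ ∷ ∀ᵣ ∷ [] →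
       PermutableAbove ρ r)
    ×
    (∀ {ρ r : Rule} → ρ ∈ nd ∷ cd ∷ [] →
       r ∈ ⊥ₗ ∷ ∧ₗ ∷ ∧ᵣ ∷ ∨ₗ ∷ ∨ᵣ ∷ ⊃ₗ ∷ ⊃ᵣ ∷ ¬ₗ ∷ ¬ᵣ ∷ ∃ₗ ∷ ∀ᵣ ∷ [] →
       PermutableAbove ρ r)
lemma2 =
    (λ ρ∈ r∈ → permutableAbove (All.lookup order-structural ρ∈) (All.lookup order-logical r∈))
  , (λ ρ∈ r∈ → permutableAbove (All.lookup domain-structural ρ∈) (All.lookup domain-logical r∈))
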